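{- Let $\zeta=e^{2\pi i/5}$, $F=\mathbb{Q}(\zeta)$ with ring of integers $\mathcal{O}$, and let $\iota=(\iota_1,\iota_2):F\to\mathbb{C}\times\mathbb{C}$ be the embeddings with $\iota_1(\zeta)=\zeta$, $\iota_2(\zeta)=\zeta^3$. For $v\in F^2$ put $q(v)=\big(\iota_1(v)\iota_1(v)^*,\ \iota_2(v)\iota_2(v)^*\big)$, a pair of $2\times 2$ complex Hermitian matrices ($v$ a column vector, $^*$ the conjugate transpose). Let $u,v\in\mathcal{O}^2$ be primitive vectors. Then $q(u)=q(v)$ if and only if $u=\tau v$ for some torsion unit (root of unity) $\tau\in\mathcal{O}$.
   Context: A vector $v=(\alpha,\beta)^t\in\mathcal{O}^2$ is primitive if the ideal $(\alpha,\beta)$ equals $\mathcal{O}$. -}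

module Defs where

open import Data.Nat using (ℕ; zero; suc)
open import Data.Integer using (ℤ; 0ℤ; 1ℤ; -_) renaming (_+_ to _+ℤ_; _*_ to _*ℤ_; _-_ to _-ℤ_)
open import Data.Product using (_×_; _,_; Σ; ∃-syntax)
open import Data.Vec using (Vec; []; _∷_)
open import Relation.Binary.PropositionalEquality using (_≡_)

-- The ring of integers 𝒪 = ℤ[ζ] of F = ℚ(ζ), ζ = e^{2πi/5}.
-- An element is a₀ + a₁ζ + a₂ζ² + a₃ζ³ ; {1,ζ,ζ²,ζ³} is a ℤ-basis of 𝒪,
-- so propositional equality of records is equality in 𝒪.
record 𝒪 : Set where
  constructor mk𝒪
  field
    a₀ a₁ a₂ a₃ : ℤ

-- reduce c₀ + c₁ζ + c₂ζ² + c₃ζ³ + c₄ζ⁴ using ζ⁴ = -1-ζ-ζ²-ζ³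
reduce : ℤ → ℤ → ℤ → ℤ → ℤ → 𝒪
reduce c₀ c₁ c₂ c₃ c₄ = mk𝒪 (c₀ -ℤ c₄) (c₁ -ℤ c₄) (c₂ -ℤ c₄) (c₃ -ℤ c₄)

0𝒪 : 𝒪
0𝒪 = mk𝒪 0ℤ 0ℤ 0ℤ 0ℤ

1𝒪 : 𝒪
1𝒪 = mk𝒪 1ℤ 0ℤ 0ℤ 0ℤ

ζ : 𝒪
ζ = mk𝒪 0ℤ 1ℤ 0ℤ 0ℤ

infixl 6 _+_
infixl 7 _*_

_+_ : 𝒪 → 𝒪 → 𝒪
mk𝒪 a b c d + mk𝒪 a' b' c' d' = mk𝒪 (a +ℤ a') (b +ℤ b') (c +ℤ c') (d +ℤ d')

-- multiplication: cyclic convolution modulo ζ⁵ = 1, then reduction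
_*_ : 𝒪 → 𝒪 → 𝒪
mk𝒪 a₀ a₁ a₂ a₃ * mk𝒪 b₀ b₁ b₂ b₃ =
  reduce (a₀ *ℤ b₀ +ℤ a₂ *ℤ b₃ +ℤ a₃ *ℤ b₂)
         (a₀ *ℤ b₁ +ℤ a₁ *ℤ b₀ +ℤ a₃ *ℤ b₃)
         (a₀ *ℤ b₂ +ℤ a₁ *ℤ b₁ +ℤ a₂ *ℤ b₀)
         (a₀ *ℤ b₃ +ℤ a₁ *ℤ b₂ +ℤ a₂ *ℤ b₁ +ℤ a₃ *ℤ b₀)
         (a₁ *ℤ b₃ +ℤ a₂ *ℤ b₂ +ℤ a₃ *ℤ b₁)

_^_ : 𝒪 → ℕ → 𝒪
x ^ zero = 1𝒪
x ^ suc n = x * (x ^ n)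

-- Galois automorphisms of F, restricted to 𝒪
-- σ₃ : ζ ↦ ζ³  (ζ↦ζ³, ζ²↦ζ, ζ³↦ζ⁴)
σ₃ : 𝒪 → 𝒪
σ₃ (mk𝒪 a₀ a₁ a₂ a₃) = reduce a₀ a₂ 0ℤ a₁ a₃

-- σ₄ : ζ ↦ ζ⁴ = ζ⁻¹  (ζ↦ζ⁴, ζ²↦ζ³, ζ³↦ζ²); this is complex conjugation
σ₄ : 𝒪 → 𝒪
σ₄ (mk𝒪 a₀ a₁ a₂ a₃) = reduce a₀ 0ℤ a₃ a₂ a₁

-- The two complex embeddings, with values in the subfield ℚ(ζ) ⊂ ℂ
-- (which is stable under complex conjugation, acting there as σ₄).
ι₁ : 𝒪 → 𝒪
ι₁ x = x

ι₂ : 𝒪 → 𝒪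
ι₂ = σ₃

conj : 𝒪 → 𝒪
conj = σ₄

𝒪² : Set
𝒪² = 𝒪 × 𝒪

-- 2×2 matrices (row-major)
Mat₂ : Set
Mat₂ = Vec (Vec 𝒪 2) 2

outer : (𝒪 → 𝒪) → 𝒪² → Mat₂
outer ι (a , b) =
  (ι a * conj (ι a) ∷ ι a * conj (ι b) ∷ []) ∷
  (ι b * conj (ι a) ∷ ι b * conj (ι b) ∷ []) ∷ []

q : 𝒪² → Mat₂ × Mat₂
q v = outer ι₁ v , outer ι₂ v

-- primitive: the ideal (α, β) is all of 𝒪, i.e. contains 1
Primitive : 𝒪² → Set
Primitive (α , β) = ∃[ x ] ∃[ y ] (x * α + y * β ≡ 1𝒪)

IsTorsionUnit : 𝒪 → Set
IsTorsionUnit τ = ∃[ n ] (τ ^ suc n ≡ 1𝒪)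

_•_ : 𝒪 → 𝒪² → 𝒪²
τ • (a , b) = τ * a , τ * b

-- Write ⟨ x , y ⟩ = x σ₄(y), so that q u = q v says that u and v have the
-- same Hermitian Gram entries ⟨ uᵢ , uⱼ ⟩ under both embeddings. The trace
-- form Q x = tr ⟨ x , x ⟩ is a sum of ten squares, and a finite check shows
-- that the only x with Q x ≤ 4 are 0 and the ten roots of unity ±ζᵏ.
--
-- If q u = q v and x c + y d = 1 for v = (c , d), then ⟨ det(u,v) , det(u,v) ⟩
-- only depends on the Gram entries, so it equals ⟨ det(v,v) , det(v,v) ⟩ = 0;
-- hence det(u,v) = 0 and u = τ v for τ = x a + y b. In the same way
-- ⟨ τ , τ ⟩ = ⟨ x c + y d , x c + y d ⟩ = 1, so Q τ = 4 and τ is a root of unity.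
--
-- Conversely, if τᵐ = 1 then N = ⟨ τ , τ ⟩ is a real element with Nᵐ = 1. If
-- tr N > 4, the traces of the powers of N, which satisfy the second-order
-- recurrence given by the characteristic polynomial of N, increase strictly
-- and cannot come back to tr 1 = 4. So Q τ ≤ 4, whence ⟨ τ , τ ⟩ = 1; the same
-- holds for σ₃ τ, and both outer products are invariant under scaling by τ.

module Submission where

open import Defs
open import Data.Product using (_×_; ∃-syntax)
open import Function.Bundles using (_⇔_)
open import Relation.Binary.PropositionalEquality using (_≡_)

open import Algebra.Bundles using (CommutativeRing)
open import Algebra.Structures using (IsCommutativeRing)
open import Data.Integer as ℤ using (ℤ; +_; -[1+_]; +[1+_]; 0ℤ; 1ℤ; _≤_; _<_; +≤+; -≤+; _≤?_)
  renaming (-_ to -ℤ_)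
import Data.Integer.Properties as ℤ
open import Data.Integer.Tactic.RingSolver using (solve)
open import Data.List using (List; _∷_; [])
open import Data.List.Membership.Propositional using (_∈_)
open import Data.List.Relation.Unary.All as All using (All; all?)
open import Data.List.Relation.Unary.Any using (here; there)
open import Data.Nat as ℕ using (ℕ; zero; suc; s≤s; z≤n)
import Data.Nat.Properties as ℕ
open import Data.Product using (_,_; proj₁; proj₂)
open import Data.Sum using (_⊎_; [_,_]′)
import Data.Vec as Vec
open import Function.Base using (id)
open import Function.Bundles using (mk⇔)
open import Level using (0ℓ)
open import Relation.Binary.Definitions using (DecidableEquality)
open import Relation.Binary.PropositionalEquality
  using (refl; sym; trans; cong; cong₂; subst; subst₂; isEquivalence; module ≡-Reasoning)
open import Relation.Nullary using (¬_; Dec; yes; no; contradiction)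
open import Relation.Nullary.Decidable using (map′; from-yes; dec⇒maybe; _×-dec_; _⊎-dec_; _→-dec_)
import Tactic.RingSolver as 𝒪-Solver
import Tactic.RingSolver.Core.AlmostCommutativeRing as ACR

open 𝒪
open ≡-Reasoning

-- The ring 𝒪

infix 8 -_

-_ : 𝒪 → 𝒪
- mk𝒪 a b c d = mk𝒪 (-ℤ a) (-ℤ b) (-ℤ c) (-ℤ d)

mk𝒪-cong : ∀ {a b c d a′ b′ c′ d′} → a ≡ a′ → b ≡ b′ → c ≡ c′ → d ≡ d′ →
           mk𝒪 a b c d ≡ mk𝒪 a′ b′ c′ d′
mk𝒪-cong refl refl refl refl = refl

infix 4 _≟_

_≟_ : DecidableEquality 𝒪
mk𝒪 a b c d ≟ mk𝒪 a′ b′ c′ d′ =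
  map′ (λ (p , q , r , s) → mk𝒪-cong p q r s)
       (λ eq → cong a₀ eq , cong a₁ eq , cong a₂ eq , cong a₃ eq)
       (a ℤ.≟ a′ ×-dec b ℤ.≟ b′ ×-dec c ℤ.≟ c′ ×-dec d ℤ.≟ d′)

-- The integer ring solver only sees through an operation of 𝒪 applied to
-- explicit coordinates, so nested operations are first unfolded with these.
*-unfold : ∀ a b c d e f g h → mk𝒪 a b c d * mk𝒪 e f g h ≡
  mk𝒪 (a ℤ.* e ℤ.+ c ℤ.* h ℤ.+ d ℤ.* g ℤ.- (b ℤ.* h ℤ.+ c ℤ.* g ℤ.+ d ℤ.* f))
      (a ℤ.* f ℤ.+ b ℤ.* e ℤ.+ d ℤ.* h ℤ.- (b ℤ.* h ℤ.+ c ℤ.* g ℤ.+ d ℤ.* f))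
      (a ℤ.* g ℤ.+ b ℤ.* f ℤ.+ c ℤ.* e ℤ.- (b ℤ.* h ℤ.+ c ℤ.* g ℤ.+ d ℤ.* f))
      (a ℤ.* h ℤ.+ b ℤ.* g ℤ.+ c ℤ.* f ℤ.+ d ℤ.* e ℤ.- (b ℤ.* h ℤ.+ c ℤ.* g ℤ.+ d ℤ.* f))
*-unfold _ _ _ _ _ _ _ _ = refl

+-unfold : ∀ a b c d e f g h →
           mk𝒪 a b c d + mk𝒪 e f g h ≡ mk𝒪 (a ℤ.+ e) (b ℤ.+ f) (c ℤ.+ g) (d ℤ.+ h)
+-unfold _ _ _ _ _ _ _ _ = refl

σ₄-unfold : ∀ a b c d → σ₄ (mk𝒪 a b c d) ≡ mk𝒪 (a ℤ.- b) (0ℤ ℤ.- b) (d ℤ.- b) (c ℤ.- b)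
σ₄-unfold _ _ _ _ = refl

σ₃-unfold : ∀ a b c d → σ₃ (mk𝒪 a b c d) ≡ mk𝒪 (a ℤ.- d) (c ℤ.- d) (0ℤ ℤ.- d) (b ℤ.- d)
σ₃-unfold _ _ _ _ = refl

+-assoc : ∀ x y z → (x + y) + z ≡ x + (y + z)
+-assoc (mk𝒪 a b c d) (mk𝒪 e f g h) (mk𝒪 i j k l) =
  mk𝒪-cong (ℤ.+-assoc a e i) (ℤ.+-assoc b f j) (ℤ.+-assoc c g k) (ℤ.+-assoc d h l)

+-comm : ∀ x y → x + y ≡ y + x
+-comm (mk𝒪 a b c d) (mk𝒪 e f g h) =
  mk𝒪-cong (ℤ.+-comm a e) (ℤ.+-comm b f) (ℤ.+-comm c g) (ℤ.+-comm d h)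

+-identityˡ : ∀ x → 0𝒪 + x ≡ x
+-identityˡ (mk𝒪 a b c d) =
  mk𝒪-cong (ℤ.+-identityˡ a) (ℤ.+-identityˡ b) (ℤ.+-identityˡ c) (ℤ.+-identityˡ d)

+-identityʳ : ∀ x → x + 0𝒪 ≡ x
+-identityʳ x = trans (+-comm x 0𝒪) (+-identityˡ x)

-‿inverseˡ : ∀ x → - x + x ≡ 0𝒪
-‿inverseˡ (mk𝒪 a b c d) =
  mk𝒪-cong (ℤ.+-inverseˡ a) (ℤ.+-inverseˡ b) (ℤ.+-inverseˡ c) (ℤ.+-inverseˡ d)

-‿inverseʳ : ∀ x → x + - x ≡ 0𝒪
-‿inverseʳ x = trans (+-comm x (- x)) (-‿inverseˡ x)

*-comm : ∀ x y → x * y ≡ y * x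
*-comm (mk𝒪 a b c d) (mk𝒪 e f g h) =
  mk𝒪-cong (solve vs) (solve vs) (solve vs) (solve vs)
  where vs = a ∷ b ∷ c ∷ d ∷ e ∷ f ∷ g ∷ h ∷ []

*-assoc : ∀ x y z → (x * y) * z ≡ x * (y * z)
*-assoc x@(mk𝒪 a b c d) (mk𝒪 e f g h) z@(mk𝒪 i j k l) =
  subst₂ _≡_ (sym (cong (_* z) (*-unfold a b c d e f g h)))
             (sym (cong (x *_) (*-unfold e f g h i j k l)))
             (mk𝒪-cong (solve vs) (solve vs) (solve vs) (solve vs))
  where vs = a ∷ b ∷ c ∷ d ∷ e ∷ f ∷ g ∷ h ∷ i ∷ j ∷ k ∷ l ∷ []

*-identityˡ : ∀ x → 1𝒪 * x ≡ x
*-identityˡ (mk𝒪 a b c d) =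
  mk𝒪-cong (solve vs) (solve vs) (solve vs) (solve vs)
  where vs = a ∷ b ∷ c ∷ d ∷ []

*-identityʳ : ∀ x → x * 1𝒪 ≡ x
*-identityʳ x = trans (*-comm x 1𝒪) (*-identityˡ x)

*-distribˡ-+ : ∀ x y z → x * (y + z) ≡ x * y + x * z
*-distribˡ-+ x@(mk𝒪 a b c d) (mk𝒪 e f g h) (mk𝒪 i j k l) =
  subst₂ _≡_ (sym (cong (x *_) (+-unfold e f g h i j k l)))
             (sym (cong₂ _+_ (*-unfold a b c d e f g h) (*-unfold a b c d i j k l)))
             (mk𝒪-cong (solve vs) (solve vs) (solve vs) (solve vs))
  where vs = a ∷ b ∷ c ∷ d ∷ e ∷ f ∷ g ∷ h ∷ i ∷ j ∷ k ∷ l ∷ []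

*-distribʳ-+ : ∀ x y z → (y + z) * x ≡ y * x + z * x
*-distribʳ-+ x y z = begin
  (y + z) * x     ≡⟨ *-comm (y + z) x ⟩
  x * (y + z)     ≡⟨ *-distribˡ-+ x y z ⟩
  x * y + x * z   ≡⟨ cong₂ _+_ (*-comm x y) (*-comm x z) ⟩
  y * x + z * x   ∎

+-*-isCommutativeRing : IsCommutativeRing _≡_ _+_ _*_ -_ 0𝒪 1𝒪
+-*-isCommutativeRing = record
  { isRing = record
    { +-isAbelianGroup = record
      { isGroup = record
        { isMonoid = record
          { isSemigroup = record
            { isMagma = record { isEquivalence = isEquivalence ; ∙-cong = cong₂ _+_ }
            ; assoc = +-assoc }
          ; identity = +-identityˡ , +-identityʳ }
        ; inverse = -‿inverseˡ , -‿inverseʳ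
        ; ⁻¹-cong = cong -_ }
      ; comm = +-comm }
    ; *-cong = cong₂ _*_
    ; *-assoc = *-assoc
    ; *-identity = *-identityˡ , *-identityʳ
    ; distrib = *-distribˡ-+ , *-distribʳ-+ }
  ; *-comm = *-comm }

+-*-commutativeRing : CommutativeRing 0ℓ 0ℓ
+-*-commutativeRing = record { isCommutativeRing = +-*-isCommutativeRing }

open CommutativeRing +-*-commutativeRing using (zeroˡ; zeroʳ; +-group; *-commutativeSemigroup)
open import Algebra.Properties.Group +-group using (inverseˡ-unique)
open import Algebra.Properties.CommutativeSemigroup *-commutativeSemigroup using (interchange)

-- Without a zero test the solver cannot cancel coefficients.
𝒪-ring : ACR.AlmostCommutativeRing 0ℓ 0ℓ
𝒪-ring = ACR.fromCommutativeRing +-*-commutativeRing (λ x → dec⇒maybe (0𝒪 ≟ x))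

σ₄-homo-+ : ∀ x y → σ₄ (x + y) ≡ σ₄ x + σ₄ y
σ₄-homo-+ (mk𝒪 a b c d) (mk𝒪 e f g h) =
  subst₂ _≡_ (sym (cong σ₄ (+-unfold a b c d e f g h)))
             (sym (cong₂ _+_ (σ₄-unfold a b c d) (σ₄-unfold e f g h)))
             (mk𝒪-cong (solve vs) (solve vs) (solve vs) (solve vs))
  where vs = a ∷ b ∷ c ∷ d ∷ e ∷ f ∷ g ∷ h ∷ []

σ₄-homo-- : ∀ x → σ₄ (- x) ≡ - σ₄ x
σ₄-homo-- x = inverseˡ-unique (σ₄ (- x)) (σ₄ x) (begin
  σ₄ (- x) + σ₄ x   ≡⟨ σ₄-homo-+ (- x) x ⟨
  σ₄ (- x + x)      ≡⟨ cong σ₄ (-‿inverseˡ x) ⟩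
  σ₄ 0𝒪             ≡⟨⟩
  0𝒪                ∎)

σ₄-homo-* : ∀ x y → σ₄ (x * y) ≡ σ₄ x * σ₄ y
σ₄-homo-* (mk𝒪 a b c d) (mk𝒪 e f g h) =
  subst₂ _≡_ (sym (cong σ₄ (*-unfold a b c d e f g h)))
             (sym (cong₂ _*_ (σ₄-unfold a b c d) (σ₄-unfold e f g h)))
             (mk𝒪-cong (solve vs) (solve vs) (solve vs) (solve vs))
  where vs = a ∷ b ∷ c ∷ d ∷ e ∷ f ∷ g ∷ h ∷ []

σ₄-involutive : ∀ x → σ₄ (σ₄ x) ≡ x
σ₄-involutive (mk𝒪 a b c d) =
  trans (cong σ₄ (σ₄-unfold a b c d)) (mk𝒪-cong (solve vs) (solve vs) (solve vs) (solve vs))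
  where vs = a ∷ b ∷ c ∷ d ∷ []

σ₃-homo-* : ∀ x y → σ₃ (x * y) ≡ σ₃ x * σ₃ y
σ₃-homo-* (mk𝒪 a b c d) (mk𝒪 e f g h) =
  subst₂ _≡_ (sym (cong σ₃ (*-unfold a b c d e f g h)))
             (sym (cong₂ _*_ (σ₃-unfold a b c d) (σ₃-unfold e f g h)))
             (mk𝒪-cong (solve vs) (solve vs) (solve vs) (solve vs))
  where vs = a ∷ b ∷ c ∷ d ∷ e ∷ f ∷ g ∷ h ∷ []

homo-^ : ∀ (f : 𝒪 → 𝒪) → f 1𝒪 ≡ 1𝒪 → (∀ x y → f (x * y) ≡ f x * f y) →
         ∀ x n → f (x ^ n) ≡ f x ^ n
homo-^ f f-1 f-* x zero    = f-1
homo-^ f f-1 f-* x (suc n) = trans (f-* x (x ^ n)) (cong (f x *_) (homo-^ f f-1 f-* x n))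

-- The Hermitian form and the trace form

⟨_,_⟩ : 𝒪 → 𝒪 → 𝒪
⟨ x , y ⟩ = x * σ₄ y

⟨⟩-* : ∀ τ x y → ⟨ τ * x , τ * y ⟩ ≡ ⟨ τ , τ ⟩ * ⟨ x , y ⟩
⟨⟩-* τ x y = trans (cong ((τ * x) *_) (σ₄-homo-* τ y)) (interchange τ x (σ₄ τ) (σ₄ y))

⟨⟩-^ : ∀ x n → ⟨ x , x ⟩ ^ n ≡ ⟨ x ^ n , x ^ n ⟩
⟨⟩-^ x zero    = refl
⟨⟩-^ x (suc n) = trans (cong (⟨ x , x ⟩ *_) (⟨⟩-^ x n)) (sym (⟨⟩-* x (x ^ n) (x ^ n)))

σ₄-⟨x,x⟩ : ∀ x → σ₄ ⟨ x , x ⟩ ≡ ⟨ x , x ⟩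
σ₄-⟨x,x⟩ x = begin
  σ₄ (x * σ₄ x)        ≡⟨ σ₄-homo-* x (σ₄ x) ⟩
  σ₄ x * σ₄ (σ₄ x)     ≡⟨ cong (σ₄ x *_) (σ₄-involutive x) ⟩
  σ₄ x * x             ≡⟨ *-comm (σ₄ x) x ⟩
  x * σ₄ x             ∎

-- The trace from F to ℚ: tr 1 = 4 and tr ζᵏ = -1 for 0 < k < 5.
tr : 𝒪 → ℤ
tr (mk𝒪 a b c d) = + 4 ℤ.* a ℤ.- b ℤ.- c ℤ.- d

tr-unfold : ∀ x {a b c d} → x ≡ mk𝒪 a b c d → tr x ≡ + 4 ℤ.* a ℤ.- b ℤ.- c ℤ.- d
tr-unfold _ refl = refl

Q : 𝒪 → ℤ
Q x = tr ⟨ x , x ⟩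

sum-of-squares : List ℤ → ℤ
sum-of-squares []       = 0ℤ
sum-of-squares (t ∷ ts) = t ℤ.* t ℤ.+ sum-of-squares ts

Q-sum-of-squares : ∀ a b c d → Q (mk𝒪 a b c d) ≡
  sum-of-squares (a ∷ b ∷ c ∷ d ∷ a ℤ.- b ∷ a ℤ.- c ∷ a ℤ.- d ∷ b ℤ.- c ∷ b ℤ.- d ∷ c ℤ.- d ∷ [])
Q-sum-of-squares a b c d = expanded
  where
  x : 𝒪
  x = mk𝒪 a b c d
  expanded : tr (x * σ₄ x) ≡
    a ℤ.* a ℤ.+ (b ℤ.* b ℤ.+ (c ℤ.* c ℤ.+ (d ℤ.* d ℤ.+
    ((a ℤ.- b) ℤ.* (a ℤ.- b) ℤ.+ ((a ℤ.- c) ℤ.* (a ℤ.- c) ℤ.+ ((a ℤ.- d) ℤ.* (a ℤ.- d) ℤ.+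
    ((b ℤ.- c) ℤ.* (b ℤ.- c) ℤ.+ ((b ℤ.- d) ℤ.* (b ℤ.- d) ℤ.+ ((c ℤ.- d) ℤ.* (c ℤ.- d) ℤ.+ 0ℤ)))))))))
  expanded = trans (tr-unfold (x * σ₄ x) (trans (cong (x *_) (σ₄-unfold a b c d)) (*-unfold a b c d _ _ _ _)))
                   (solve (a ∷ b ∷ c ∷ d ∷ []))

0≤i*i : ∀ i → 0ℤ ≤ i ℤ.* i
0≤i*i (+ n)    = subst (0ℤ ≤_) (sym (ℤ.+◃n≡+n (n ℕ.* n))) (+≤+ z≤n)
0≤i*i -[1+ n ] = +≤+ z≤n

0≤i*j : ∀ {i j} → 0ℤ ≤ i → 0ℤ ≤ j → 0ℤ ≤ i ℤ.* j
0≤i*j {+ m} {+ n} _ _ = subst (0ℤ ≤_) (sym (ℤ.+◃n≡+n (m ℕ.* n))) (+≤+ z≤n)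

0≤sum-of-squares : ∀ ts → 0ℤ ≤ sum-of-squares ts
0≤sum-of-squares []       = ℤ.≤-refl
0≤sum-of-squares (t ∷ ts) = ℤ.+-mono-≤ (0≤i*i t) (0≤sum-of-squares ts)

∈⇒square≤sum-of-squares : ∀ {t ts} → t ∈ ts → t ℤ.* t ≤ sum-of-squares ts
∈⇒square≤sum-of-squares {t} {_ ∷ ts} (here refl) =
  ℤ.i≤i+j (t ℤ.* t) (sum-of-squares ts) {{ℤ.nonNegative (0≤sum-of-squares ts)}}
∈⇒square≤sum-of-squares {t} {s ∷ ts} (there t∈ts) =
  ℤ.≤-trans (∈⇒square≤sum-of-squares t∈ts)
            (ℤ.i≤j+i (sum-of-squares ts) (s ℤ.* s) {{ℤ.nonNegative (0≤i*i s)}})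

window : List ℤ
window = -[1+ 1 ] ∷ -[1+ 0 ] ∷ + 0 ∷ + 1 ∷ + 2 ∷ []

[3+n]²≰4 : ∀ n → ¬ ((3 ℕ.+ n) ℕ.* (3 ℕ.+ n) ℕ.≤ 4)
[3+n]²≰4 n le with ℕ.≤-trans (ℕ.*-mono-≤ (ℕ.m≤m+n 3 n) (ℕ.m≤m+n 3 n)) le
... | s≤s (s≤s (s≤s (s≤s ())))

square≤4⇒∈window : ∀ t → t ℤ.* t ≤ + 4 → t ∈ window
square≤4⇒∈window (+ 0)                 _         = there (there (here refl))
square≤4⇒∈window (+ 1)                 _         = there (there (there (here refl)))
square≤4⇒∈window (+ 2)                 _         = there (there (there (there (here refl))))
square≤4⇒∈window (+ suc (suc (suc n))) (+≤+ le)  = contradiction le ([3+n]²≰4 n)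
square≤4⇒∈window -[1+ 0 ]              _         = there (here refl)
square≤4⇒∈window -[1+ 1 ]              _         = here refl
square≤4⇒∈window -[1+ suc (suc n) ]    (+≤+ le)  = contradiction le ([3+n]²≰4 n)

ZeroOrRootOfUnity : 𝒪 → Set
ZeroOrRootOfUnity x = x ≡ 0𝒪 ⊎ (⟨ x , x ⟩ ≡ 1𝒪 × x ^ 10 ≡ 1𝒪)

Q≤4⇒zero-or-root-of-unity? : ∀ x → Dec (Q x ≤ + 4 → ZeroOrRootOfUnity x)
Q≤4⇒zero-or-root-of-unity? x =
  (Q x ≤? + 4) →-dec ((x ≟ 0𝒪) ⊎-dec ((⟨ x , x ⟩ ≟ 1𝒪) ×-dec (x ^ 10 ≟ 1𝒪)))

Q≤4⇒zero-or-root-of-unity-on-window :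
  All (λ a → All (λ b → All (λ c → All (λ d →
    Q (mk𝒪 a b c d) ≤ + 4 → ZeroOrRootOfUnity (mk𝒪 a b c d)) window) window) window) window
Q≤4⇒zero-or-root-of-unity-on-window = from-yes (all? (λ a → all? (λ b → all? (λ c → all? (λ d →
  Q≤4⇒zero-or-root-of-unity? (mk𝒪 a b c d)) window) window) window) window)

Q≤4⇒zero-or-root-of-unity : ∀ x → Q x ≤ + 4 → ZeroOrRootOfUnity x
Q≤4⇒zero-or-root-of-unity (mk𝒪 a b c d) Q≤4 =
  All.lookup (All.lookup (All.lookup (All.lookup Q≤4⇒zero-or-root-of-unity-on-window
    (∈window (here refl))) (∈window (there (here refl)))) (∈window (there (there (here refl)))))
    (∈window (there (there (there (here refl))))) Q≤4
  where
  ∈window : ∀ {t} → t ∈ (a ∷ b ∷ c ∷ d ∷ a ℤ.- b ∷ a ℤ.- c ∷ a ℤ.- d ∷ b ℤ.- c ∷ b ℤ.- d ∷ c ℤ.- d ∷ []) →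
            t ∈ window
  ∈window t∈ = square≤4⇒∈window _
    (ℤ.≤-trans (∈⇒square≤sum-of-squares t∈) (subst (_≤ + 4) (Q-sum-of-squares a b c d) Q≤4))

0≢1 : ¬ (0𝒪 ≡ 1𝒪)
0≢1 ()

⟨x,x⟩≡0⇒x≡0 : ∀ x → ⟨ x , x ⟩ ≡ 0𝒪 → x ≡ 0𝒪
⟨x,x⟩≡0⇒x≡0 x ⟨x,x⟩≡0 =
  [ id , (λ (⟨x,x⟩≡1 , _) → contradiction (trans (sym ⟨x,x⟩≡0) ⟨x,x⟩≡1) 0≢1) ]′
  (Q≤4⇒zero-or-root-of-unity x (subst (_≤ + 4) (sym (cong tr ⟨x,x⟩≡0)) (+≤+ z≤n)))

⟨x,x⟩≡1⇒x^10≡1 : ∀ x → ⟨ x , x ⟩ ≡ 1𝒪 → x ^ 10 ≡ 1𝒪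
⟨x,x⟩≡1⇒x^10≡1 x ⟨x,x⟩≡1 =
  [ (λ x≡0 → contradiction (trans (sym (cong (λ z → ⟨ z , z ⟩) x≡0)) ⟨x,x⟩≡1) 0≢1) , proj₂ ]′
  (Q≤4⇒zero-or-root-of-unity x (subst (_≤ + 4) (sym (cong tr ⟨x,x⟩≡1)) ℤ.≤-refl))

-- Roots of unity among real elements

-- x + y(ζ² + ζ³), a general element of 𝒪 ∩ ℚ(√5).
real : ℤ → ℤ → 𝒪
real x y = mk𝒪 x 0ℤ y y

σ₄-real : ∀ x y → σ₄ (real x y) ≡ real x y
σ₄-real x y = trans (σ₄-unfold x 0ℤ y y) (mk𝒪-cong (solve vs) (solve vs) (solve vs) (solve vs))
  where vs = x ∷ y ∷ []

0-i≡i⇒i≡0 : ∀ i → 0ℤ ℤ.- i ≡ i → i ≡ 0ℤ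
0-i≡i⇒i≡0 (+ zero) _  = refl
0-i≡i⇒i≡0 +[1+ n ] ()
0-i≡i⇒i≡0 -[1+ n ] ()

σ₄-fixed⇒real : ∀ z → σ₄ z ≡ z → z ≡ real (a₀ z) (a₂ z)
σ₄-fixed⇒real (mk𝒪 a b c d) σ₄z≡z = mk𝒪-cong refl b≡0 refl d≡c
  where
  b≡0 : b ≡ 0ℤ
  b≡0 = 0-i≡i⇒i≡0 b (cong a₁ σ₄z≡z)
  d≡c : d ≡ c
  d≡c = begin
    d          ≡⟨ cong a₃ σ₄z≡z ⟨
    c ℤ.- b    ≡⟨ cong (λ i → c ℤ.- i) b≡0 ⟩
    c ℤ.- 0ℤ   ≡⟨ ℤ.+-identityʳ c ⟩
    c          ∎

-- The norm from ℚ(√5) to ℚ; only meaningful on real elements.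
norm⁺ : 𝒪 → ℤ
norm⁺ z = a₀ z ℤ.* a₀ z ℤ.- a₀ z ℤ.* a₂ z ℤ.- a₂ z ℤ.* a₂ z

norm⁺-unfold : ∀ z {a b c d} → z ≡ mk𝒪 a b c d → norm⁺ z ≡ a ℤ.* a ℤ.- a ℤ.* c ℤ.- c ℤ.* c
norm⁺-unfold _ refl = refl

norm⁺-real-* : ∀ x y u v → norm⁺ (real x y * real u v) ≡ norm⁺ (real x y) ℤ.* norm⁺ (real u v)
norm⁺-real-* x y u v =
  subst₂ _≡_ (sym (norm⁺-unfold (real x y * real u v) (*-unfold x 0ℤ y y u 0ℤ v v)))
             (sym (cong₂ ℤ._*_ (norm⁺-unfold (real x y) refl) (norm⁺-unfold (real u v) refl)))
             (solve (x ∷ y ∷ u ∷ v ∷ []))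

tr-real : ∀ z {x y} → z ≡ real x y → tr z ≡ + 2 ℤ.* (+ 2 ℤ.* x ℤ.- y)
tr-real _ {x} {y} refl = trans (tr-unfold (real x y) refl) (solve (x ∷ y ∷ []))

real-*-real : ∀ x y u v →
  real x y * real u v ≡ real (x ℤ.* u ℤ.+ y ℤ.* v) (x ℤ.* v ℤ.+ y ℤ.* u ℤ.- y ℤ.* v)
real-*-real x y u v = trans (*-unfold x 0ℤ y y u 0ℤ v v) (mk𝒪-cong (solve vs) (solve vs) (solve vs) (solve vs))
  where vs = x ∷ y ∷ u ∷ v ∷ []

-- x + y(ζ² + ζ³) is a root of X² - (2x - y) X + norm⁺ (x + y(ζ² + ζ³)).
tr-real-cayley-hamilton : ∀ x y u v → tr (real x y * (real x y * real u v)) ≡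
  (+ 2 ℤ.* x ℤ.- y) ℤ.* tr (real x y * real u v) ℤ.- norm⁺ (real x y) ℤ.* tr (real u v)
tr-real-cayley-hamilton x y u v =
  subst₂ _≡_ (sym (tr-real (N * (N * M))
                           (trans (cong (N *_) (real-*-real x y u v))
                                  (real-*-real x y (x ℤ.* u ℤ.+ y ℤ.* v) (x ℤ.* v ℤ.+ y ℤ.* u ℤ.- y ℤ.* v)))))
             (sym (cong₂ (λ p q → (+ 2 ℤ.* x ℤ.- y) ℤ.* p ℤ.- (x ℤ.* x ℤ.- x ℤ.* y ℤ.- y ℤ.* y) ℤ.* q)
                         (tr-real (N * M) (real-*-real x y u v)) (tr-real M refl)))
             (solve (x ∷ y ∷ u ∷ v ∷ []))
  where
  N M : 𝒪
  N = real x y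
  M = real u v

i*j≡1⇒i≤1 : ∀ i j → i ℤ.* j ≡ 1ℤ → i ≤ 1ℤ
i*j≡1⇒i≤1 (+ 0)             _ _  = +≤+ z≤n
i*j≡1⇒i≤1 (+ 1)             _ _  = ℤ.≤-refl
i*j≡1⇒i≤1 (+ suc (suc n))   j ij≡1
  with ℕ.m*n≡1⇒m≡1 (suc (suc n)) ℤ.∣ j ∣ (trans (sym (ℤ.abs-* (+ suc (suc n)) j)) (cong ℤ.∣_∣ ij≡1))
... | ()
i*j≡1⇒i≤1 -[1+ n ]          _ _  = -≤+

recurrence-step : ∀ {s ν u v} → + 2 ≤ s → ν ≤ 1ℤ → 0ℤ ≤ u → u < v → v < s ℤ.* v ℤ.- ν ℤ.* u
recurrence-step {s} {ν} {u} {v} 2≤s ν≤1 0≤u u<v =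
  ℤ.suc[i]≤j⇒i<j (ℤ.0≤i-j⇒j≤i (subst (0ℤ ≤_) (sym rearrange) nonneg))
  where
  rearrange : s ℤ.* v ℤ.- ν ℤ.* u ℤ.- (1ℤ ℤ.+ v) ≡
              (s ℤ.- + 2) ℤ.* v ℤ.+ (v ℤ.- (1ℤ ℤ.+ u)) ℤ.+ (1ℤ ℤ.- ν) ℤ.* u
  rearrange = solve vs
    where vs = s ∷ ν ∷ u ∷ v ∷ []
  nonneg : 0ℤ ≤ (s ℤ.- + 2) ℤ.* v ℤ.+ (v ℤ.- (1ℤ ℤ.+ u)) ℤ.+ (1ℤ ℤ.- ν) ℤ.* u
  nonneg = ℤ.+-mono-≤ (ℤ.+-mono-≤ (0≤i*j (ℤ.i≤j⇒0≤j-i 2≤s) (ℤ.≤-trans 0≤u (ℤ.<⇒≤ u<v)))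
                                  (ℤ.i≤j⇒0≤j-i (ℤ.i<j⇒suc[i]≤j u<v)))
                      (0≤i*j (ℤ.i≤j⇒0≤j-i ν≤1) 0≤u)

recurrence-increasing : ∀ {s ν} (t : ℕ → ℤ) → + 2 ≤ s → ν ≤ 1ℤ →
  (∀ k → t (suc (suc k)) ≡ s ℤ.* t (suc k) ℤ.- ν ℤ.* t k) →
  0ℤ ≤ t 0 → t 0 < t 1 → ∀ k → t 0 < t (suc k)
recurrence-increasing t 2≤s ν≤1 rec 0≤t₀ t₀<t₁ = from-start
  where
  step : ∀ k → 0ℤ ≤ t k × t k < t (suc k)
  step zero    = 0≤t₀ , t₀<t₁
  step (suc k) with step k
  ... | 0≤tₖ , tₖ<tₖ₊₁ = ℤ.≤-trans 0≤tₖ (ℤ.<⇒≤ tₖ<tₖ₊₁)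
                       , subst (t (suc k) <_) (sym (rec k)) (recurrence-step 2≤s ν≤1 0≤tₖ tₖ<tₖ₊₁)
  from-start : ∀ k → t 0 < t (suc k)
  from-start zero    = t₀<t₁
  from-start (suc k) = ℤ.<-trans (from-start k) (proj₂ (step (suc k)))

real-torsion⇒tr≤4 : ∀ x y n → real x y ^ suc n ≡ 1𝒪 → tr (real x y) ≤ + 4
real-torsion⇒tr≤4 x y n Nᵐ≡1 = ℤ.≮⇒≥ (λ 4<trN → ℤ.<-irrefl (sym (cong tr Nᵐ≡1)) (grows 4<trN))
  where
  N : 𝒪
  N = real x y
  t : ℕ → ℤ
  t k = tr (N ^ k)
  Nᵏ≡real : ∀ k → N ^ k ≡ real (a₀ (N ^ k)) (a₂ (N ^ k))
  Nᵏ≡real k = σ₄-fixed⇒real (N ^ k) (trans (homo-^ σ₄ refl σ₄-homo-* N k) (cong (_^ k) (σ₄-real x y)))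
  u v : ℤ
  u = a₀ (N ^ n)
  v = a₂ (N ^ n)
  ν≤1 : norm⁺ N ≤ 1ℤ
  ν≤1 = i*j≡1⇒i≤1 (norm⁺ N) (norm⁺ (real u v)) (begin
    norm⁺ N ℤ.* norm⁺ (real u v)   ≡⟨ norm⁺-real-* x y u v ⟨
    norm⁺ (N * real u v)           ≡⟨ cong (λ z → norm⁺ (N * z)) (Nᵏ≡real n) ⟨
    norm⁺ (N ^ suc n)              ≡⟨ cong norm⁺ Nᵐ≡1 ⟩
    1ℤ                             ∎)
  2≤s : + 4 < tr N → + 2 ≤ + 2 ℤ.* x ℤ.- y
  2≤s 4<trN = ℤ.<⇒≤ (ℤ.*-cancelˡ-<-nonNeg {+ 2} (+ 2) (subst (+ 4 <_) (tr-real N refl) 4<trN))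
  recurrence : ∀ k → t (suc (suc k)) ≡ (+ 2 ℤ.* x ℤ.- y) ℤ.* t (suc k) ℤ.- norm⁺ N ℤ.* t k
  recurrence k = subst (λ z → tr (N * (N * z)) ≡ (+ 2 ℤ.* x ℤ.- y) ℤ.* tr (N * z) ℤ.- norm⁺ N ℤ.* tr z)
                       (sym (Nᵏ≡real k)) (tr-real-cayley-hamilton x y _ _)
  grows : + 4 < tr N → t 0 < t (suc n)
  grows 4<trN = recurrence-increasing t (2≤s 4<trN) ν≤1 recurrence
    (+≤+ z≤n) (subst (+ 4 <_) (cong tr (sym (*-identityʳ N))) 4<trN) n

σ₄-fixed-torsion⇒tr≤4 : ∀ z n → σ₄ z ≡ z → z ^ suc n ≡ 1𝒪 → tr z ≤ + 4
σ₄-fixed-torsion⇒tr≤4 z n σ₄z≡z zᵐ≡1 =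
  subst (λ w → tr w ≤ + 4) (sym z≡real)
        (real-torsion⇒tr≤4 (a₀ z) (a₂ z) n (subst (λ w → w ^ suc n ≡ 1𝒪) z≡real zᵐ≡1))
  where
  z≡real : z ≡ real (a₀ z) (a₂ z)
  z≡real = σ₄-fixed⇒real z σ₄z≡z

torsion⇒⟨x,x⟩≡1 : ∀ x n → x ^ suc n ≡ 1𝒪 → ⟨ x , x ⟩ ≡ 1𝒪
torsion⇒⟨x,x⟩≡1 x n xᵐ≡1 with Q x ≤? + 4
... | yes Q≤4 = [ (λ x≡0 → contradiction (trans (sym 0ᵐ≡0) (trans (cong (_^ suc n) (sym x≡0)) xᵐ≡1)) 0≢1)
                , proj₁ ]′ (Q≤4⇒zero-or-root-of-unity x Q≤4)
  where
  0ᵐ≡0 : 0𝒪 ^ suc n ≡ 0𝒪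
  0ᵐ≡0 = zeroˡ (0𝒪 ^ n)
... | no Q≰4  = contradiction (σ₄-fixed-torsion⇒tr≤4 ⟨ x , x ⟩ n (σ₄-⟨x,x⟩ x) Nᵐ≡1) Q≰4
  where
  Nᵐ≡1 : ⟨ x , x ⟩ ^ suc n ≡ 1𝒪
  Nᵐ≡1 = trans (⟨⟩-^ x (suc n)) (cong (λ z → ⟨ z , z ⟩) xᵐ≡1)

-- Outer products

infixr 5 ⟦_,_⟧
pattern ⟦_,_⟧ x y = x Vec.∷ y Vec.∷ Vec.[]

_·_ : 𝒪² → 𝒪² → 𝒪
(x , y) · (a , b) = x * a + y * b

det : 𝒪² → 𝒪² → 𝒪
det (a , b) (c , d) = a * d + - (b * c)

det-self : ∀ v → det v v ≡ 0𝒪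
det-self (a , b) = trans (cong (λ z → a * b + - z) (*-comm b a)) (-‿inverseʳ (a * b))

det≡0⇒proportional : ∀ w u v → det u v ≡ 0𝒪 → w · v ≡ 1𝒪 → u ≡ (w · u) • v
det≡0⇒proportional (x , y) (a , b) (c , d) det≡0 w·v≡1 = cong₂ _,_ (sym τc≡a) (sym τd≡b)
  where
  τc≡a : (x * a + y * b) * c ≡ a
  τc≡a = begin
    (x * a + y * b) * c                         ≡⟨ expand x y a b c d ⟩
    a * (x * c + y * d) + - (y * (a * d + - (b * c)))  ≡⟨ cong₂ (λ p z → a * p + - (y * z)) w·v≡1 det≡0 ⟩
    a * 1𝒪 + - (y * 0𝒪)                         ≡⟨ cong₂ (λ p z → p + - z) (*-identityʳ a) (zeroʳ y) ⟩
    a + 0𝒪                                      ≡⟨ +-identityʳ a ⟩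
    a                                           ∎
    where
    expand : ∀ x y a b c d → (x * a + y * b) * c ≡ a * (x * c + y * d) + - (y * (a * d + - (b * c)))
    expand x y a b c d = 𝒪-Solver.solve (x ∷ y ∷ a ∷ b ∷ c ∷ d ∷ []) 𝒪-ring
  τd≡b : (x * a + y * b) * d ≡ b
  τd≡b = begin
    (x * a + y * b) * d                         ≡⟨ expand x y a b c d ⟩
    b * (x * c + y * d) + x * (a * d + - (b * c))  ≡⟨ cong₂ (λ p z → b * p + x * z) w·v≡1 det≡0 ⟩
    b * 1𝒪 + x * 0𝒪                             ≡⟨ cong₂ _+_ (*-identityʳ b) (zeroʳ x) ⟩
    b + 0𝒪                                      ≡⟨ +-identityʳ b ⟩
    b                                           ∎
    where
    expand : ∀ x y a b c d → (x * a + y * b) * d ≡ b * (x * c + y * d) + x * (a * d + - (b * c))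
    expand x y a b c d = 𝒪-Solver.solve (x ∷ y ∷ a ∷ b ∷ c ∷ d ∷ []) 𝒪-ring

quadratic : 𝒪² → Mat₂ → 𝒪
quadratic (x , y) ⟦ ⟦ m₁₁ , m₁₂ ⟧ , ⟦ m₂₁ , m₂₂ ⟧ ⟧ =
  ⟨ x , x ⟩ * m₁₁ + ⟨ x , y ⟩ * m₁₂ + ⟨ y , x ⟩ * m₂₁ + ⟨ y , y ⟩ * m₂₂

mixed-det : Mat₂ → Mat₂ → 𝒪
mixed-det ⟦ ⟦ m₁₁ , m₁₂ ⟧ , ⟦ m₂₁ , m₂₂ ⟧ ⟧ ⟦ ⟦ n₁₁ , n₁₂ ⟧ , ⟦ n₂₁ , n₂₂ ⟧ ⟧ =
  m₁₁ * n₂₂ + - (m₁₂ * n₂₁) + - (m₂₁ * n₁₂) + m₂₂ * n₁₁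

foil : ∀ p q r s → (p + q) * (r + s) ≡ p * r + p * s + q * r + q * s
foil p q r s = 𝒪-Solver.solve (p ∷ q ∷ r ∷ s ∷ []) 𝒪-ring

foil-minus : ∀ p q r s → (p + - q) * (r + - s) ≡ p * r + - (p * s) + - (q * r) + q * s
foil-minus p q r s = 𝒪-Solver.solve (p ∷ q ∷ r ∷ s ∷ []) 𝒪-ring

⟨·,·⟩≡quadratic : ∀ w u → ⟨ w · u , w · u ⟩ ≡ quadratic w (outer ι₁ u)
⟨·,·⟩≡quadratic (x , y) (a , b) = begin
  (x * a + y * b) * σ₄ (x * a + y * b)
    ≡⟨ cong ((x * a + y * b) *_) σ₄-expand ⟩
  (x * a + y * b) * (σ₄ x * σ₄ a + σ₄ y * σ₄ b)
    ≡⟨ foil (x * a) (y * b) (σ₄ x * σ₄ a) (σ₄ y * σ₄ b) ⟩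
  x * a * (σ₄ x * σ₄ a) + x * a * (σ₄ y * σ₄ b) + y * b * (σ₄ x * σ₄ a) + y * b * (σ₄ y * σ₄ b)
    ≡⟨ cong₂ _+_ (cong₂ _+_ (cong₂ _+_ (interchange x a (σ₄ x) (σ₄ a)) (interchange x a (σ₄ y) (σ₄ b)))
                                      (interchange y b (σ₄ x) (σ₄ a)))
                            (interchange y b (σ₄ y) (σ₄ b)) ⟩
  quadratic (x , y) (outer ι₁ (a , b))
    ∎
  where
  σ₄-expand : σ₄ (x * a + y * b) ≡ σ₄ x * σ₄ a + σ₄ y * σ₄ b
  σ₄-expand = trans (σ₄-homo-+ (x * a) (y * b)) (cong₂ _+_ (σ₄-homo-* x a) (σ₄-homo-* y b))

⟨det,det⟩≡mixed-det : ∀ u v → ⟨ det u v , det u v ⟩ ≡ mixed-det (outer ι₁ u) (outer ι₁ v)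
⟨det,det⟩≡mixed-det (a , b) (c , d) = begin
  (a * d + - (b * c)) * σ₄ (a * d + - (b * c))
    ≡⟨ cong ((a * d + - (b * c)) *_) σ₄-expand ⟩
  (a * d + - (b * c)) * (σ₄ a * σ₄ d + - (σ₄ b * σ₄ c))
    ≡⟨ foil-minus (a * d) (b * c) (σ₄ a * σ₄ d) (σ₄ b * σ₄ c) ⟩
  a * d * (σ₄ a * σ₄ d) + - (a * d * (σ₄ b * σ₄ c)) + - (b * c * (σ₄ a * σ₄ d)) + b * c * (σ₄ b * σ₄ c)
    ≡⟨ cong₂ _+_ (cong₂ _+_ (cong₂ _+_ (interchange a d (σ₄ a) (σ₄ d))
                                       (cong -_ (interchange a d (σ₄ b) (σ₄ c))))
                            (cong -_ (interchange b c (σ₄ a) (σ₄ d))))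
                 (interchange b c (σ₄ b) (σ₄ c)) ⟩
  mixed-det (outer ι₁ (a , b)) (outer ι₁ (c , d))
    ∎
  where
  σ₄-expand : σ₄ (a * d + - (b * c)) ≡ σ₄ a * σ₄ d + - (σ₄ b * σ₄ c)
  σ₄-expand = trans (σ₄-homo-+ (a * d) (- (b * c)))
                    (cong₂ _+_ (σ₄-homo-* a d) (trans (σ₄-homo-- (b * c)) (cong -_ (σ₄-homo-* b c))))

same-outer₁⇒unimodular-multiple : ∀ u v → Primitive v → outer ι₁ u ≡ outer ι₁ v →
  ∃[ τ ] (⟨ τ , τ ⟩ ≡ 1𝒪 × u ≡ τ • v)
same-outer₁⇒unimodular-multiple u v@(_ , _) (x , y , w·v≡1) outer≡ =
  w · u , ⟨w·u,w·u⟩≡1 , det≡0⇒proportional w u v det≡0 w·v≡1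
  where
  w : 𝒪²
  w = x , y
  det≡0 : det u v ≡ 0𝒪
  det≡0 = ⟨x,x⟩≡0⇒x≡0 (det u v) (begin
    ⟨ det u v , det u v ⟩                    ≡⟨ ⟨det,det⟩≡mixed-det u v ⟩
    mixed-det (outer ι₁ u) (outer ι₁ v)      ≡⟨ cong (λ M → mixed-det M (outer ι₁ v)) outer≡ ⟩
    mixed-det (outer ι₁ v) (outer ι₁ v)      ≡⟨ ⟨det,det⟩≡mixed-det v v ⟨
    ⟨ det v v , det v v ⟩                    ≡⟨ cong (λ z → ⟨ z , z ⟩) (det-self v) ⟩
    0𝒪                                       ∎)
  ⟨w·u,w·u⟩≡1 : ⟨ w · u , w · u ⟩ ≡ 1𝒪
  ⟨w·u,w·u⟩≡1 = begin
    ⟨ w · u , w · u ⟩                        ≡⟨ ⟨·,·⟩≡quadratic w u ⟩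
    quadratic w (outer ι₁ u)                 ≡⟨ cong (quadratic w) outer≡ ⟩
    quadratic w (outer ι₁ v)                 ≡⟨ ⟨·,·⟩≡quadratic w v ⟨
    ⟨ w · v , w · v ⟩                        ≡⟨ cong (λ z → ⟨ z , z ⟩) w·v≡1 ⟩
    1𝒪                                       ∎

outer-•-unimodular : ∀ (ι : 𝒪 → 𝒪) → (∀ x y → ι (x * y) ≡ ι x * ι y) →
  ∀ τ → ⟨ ι τ , ι τ ⟩ ≡ 1𝒪 → ∀ v → outer ι (τ • v) ≡ outer ι v
outer-•-unimodular ι ι-homo-* τ ⟨ιτ,ιτ⟩≡1 (c , d) =
  cong₂ ⟦_,_⟧ (cong₂ ⟦_,_⟧ (entry c c) (entry c d)) (cong₂ ⟦_,_⟧ (entry d c) (entry d d))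
  where
  entry : ∀ x y → ⟨ ι (τ * x) , ι (τ * y) ⟩ ≡ ⟨ ι x , ι y ⟩
  entry x y = begin
    ⟨ ι (τ * x) , ι (τ * y) ⟩       ≡⟨ cong₂ ⟨_,_⟩ (ι-homo-* τ x) (ι-homo-* τ y) ⟩
    ⟨ ι τ * ι x , ι τ * ι y ⟩       ≡⟨ ⟨⟩-* (ι τ) (ι x) (ι y) ⟩
    ⟨ ι τ , ι τ ⟩ * ⟨ ι x , ι y ⟩   ≡⟨ cong (_* ⟨ ι x , ι y ⟩) ⟨ιτ,ιτ⟩≡1 ⟩
    1𝒪 * ⟨ ι x , ι y ⟩              ≡⟨ *-identityˡ ⟨ ι x , ι y ⟩ ⟩
    ⟨ ι x , ι y ⟩                   ∎

proposition5p2 : (u v : 𝒪²) → Primitive u → Primitive v →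
    (q u ≡ q v) ⇔ (∃[ τ ] (IsTorsionUnit τ × u ≡ τ • v))
-- Only v has to be primitive: its Bézout coefficients give τ.
proposition5p2 u v _ v-primitive = mk⇔ same-q⇒multiple multiple⇒same-q
  where
  same-q⇒multiple : q u ≡ q v → ∃[ τ ] (IsTorsionUnit τ × u ≡ τ • v)
  same-q⇒multiple q≡ =
    let τ , ⟨τ,τ⟩≡1 , u≡τv = same-outer₁⇒unimodular-multiple u v v-primitive (cong proj₁ q≡)
    in τ , (9 , ⟨x,x⟩≡1⇒x^10≡1 τ ⟨τ,τ⟩≡1) , u≡τv
  multiple⇒same-q : ∃[ τ ] (IsTorsionUnit τ × u ≡ τ • v) → q u ≡ q v
  multiple⇒same-q (τ , (n , τᵐ≡1) , u≡τv) = subst (λ w → q w ≡ q v) (sym u≡τv) (cong₂ _,_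
    (outer-•-unimodular ι₁ (λ _ _ → refl) τ (torsion⇒⟨x,x⟩≡1 τ n τᵐ≡1) v)
    (outer-•-unimodular ι₂ σ₃-homo-* τ (torsion⇒⟨x,x⟩≡1 (σ₃ τ) n σ₃τᵐ≡1) v))
    where
    σ₃τᵐ≡1 : σ₃ τ ^ suc n ≡ 1𝒪
    σ₃τᵐ≡1 = trans (sym (homo-^ σ₃ refl σ₃-homo-* τ (suc n))) (cong σ₃ τᵐ≡1)
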